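{- Let $e_1,\dots,e_m$ be any multigraph edge stream, $\alpha,\beta\in(0,1)$, $\Delta t\ge0$, and run MG-Triangle$(\alpha,\beta,\Delta t)$ as described in the context. For every time $t$, the output $\widehat T_t$ satisfies $\mathbf E[\widehat T_t]=|T_t|$, where $T_t$ is the set of triangles of the simple graph $G_t$ formed by the edges $e_s$, $\max(1,t-\Delta t)\le s\le t$.
   Context: A multigraph edge stream is a sequence $e_1,\dots,e_m$ of unordered pairs of distinct vertex ids; the same pair may occur several times. For $t'\le t$, $G[t',t]$ denotes the simple undirected graph whose edge set is the set of distinct pairs among $e_{t'},\dots,e_t$; $G_t=G[\max(1,t-\Delta t),t]$. A wedge is a path of length $2$, i.e. an unordered pair of distinct edges $\{(u,v),(u,w)\}$ sharing exactly one vertex $u$; its closing edge is $(v,w)$. $W_t$ and $T_t$ denote the sets of wedges and triangles of $G_t$. $hash$ is a uniformly random function assigning to every edge and every wedge an independent uniform value in $(0,1)$; expectations are over $hash$ only. Algorithm MG-Triangle$(\alpha,\beta,\Delta t)$ keeps a set \textit{e-list} of edges, a set \textit{w-list} of wedges, and for each $w\in$ \textit{w-list} a bit $X_w$; all start empty. For each $t=1,\dots,m$, on seeing $e_t$: (1) Update: if $hash(e_t)\le\alpha$ and $e_t\notin$ \textit{e-list}, insert $e_t$ into \textit{e-list}, and for each wedge $w=\{e,e_t\}$ with $e\in$ \textit{e-list}, if $hash(w)\le\beta$ and $w\notin$ \textit{w-list}, insert $w$ into \textit{w-list} (with $X_w=0$). (2) For each $w=\{(u,v),(u,w')\}\in$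 \textit{w-list}: if $e_t$ is the closing edge $(v,w')$ set $X_w=1$; else if $e_t\in\{(u,v),(u,w')\}$ reset $X_w=0$. (3) Let $\mathcal W$ be the set of wedges in \textit{w-list} that belong to $W_t$; output $\widehat T_t=(\alpha^2\beta)^{ -1}\sum_{w\in\mathcal W}X_w$, $\widehat W_t=(\alpha^2\beta)^{ -1}|\mathcal W|$, and $\widehat\tau_t=3\widehat T_t/\widehat W_t$ (with $\widehat\tau_t=0$ if $\widehat W_t=0$).
   Formalization: The parameters α and β range over the rationals in (0,1). -}

module Defs where

open import Data.Nat as ℕ using (ℕ; _⊔_; _⊓_; _∸_; _≡ᵇ_)
open import Data.Integer using (+_)
open import Data.Product using (_×_; _,_; proj₁; proj₂)
open import Data.Product.Properties using (≡-dec)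
open import Data.Bool using (Bool; true; false; if_then_else_; _∧_; not)
open import Data.Maybe using (Maybe; just; nothing)
open import Data.Sum using (_⊎_; inj₁; inj₂)
open import Data.Sum.Properties using () renaming (≡-dec to ⊎-≡-dec)
open import Data.List using (List; []; _∷_; _++_; [_]; map; foldl; take; drop; length; mapMaybe; cartesianProduct)
open import Data.Bool.ListAction using (any)
open import Data.List.Membership.Propositional using (_∈_)
open import Data.Rational as ℚ using (ℚ; 0ℚ; 1ℚ; _/_)
open import Relation.Nullary using (yes; no)
open import Relation.Nullary.Decidable using (⌊_⌋)
open import Relation.Binary.Definitions using (DecidableEquality)
open import Relation.Binary.PropositionalEquality using (_≡_)

-- An (undirected) edge {u,v}, u ≠ v, is
-- represented canonically by the ordered pair (min u v , max u v).
-- A wedge {(u,v),(u,w)} (center u, v ≠ w) is represented canonically by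
-- the triple (u , min v w , max v w); its closing edge is (min v w , max v w).

Edge : Set
Edge = ℕ × ℕ

Wedge : Set
Wedge = ℕ × ℕ × ℕ

norm : ℕ × ℕ → Edge
norm (u , v) = (u ⊓ v , u ⊔ v)

_≟E_ : DecidableEquality Edge
_≟E_ = ≡-dec ℕ._≟_ ℕ._≟_

_≟W_ : DecidableEquality Wedge
_≟W_ = ≡-dec ℕ._≟_ _≟E_

_∈?E_ : Edge → List Edge → Bool
e ∈?E es = any (λ f → ⌊ e ≟E f ⌋) es

_∈?W_ : Wedge → List Wedge → Bool
w ∈?W ws = any (λ v → ⌊ w ≟W v ⌋) ws

wedgeEdges : Wedge → List Edge
wedgeEdges (u , v , w) = norm (u , v) ∷ norm (u , w) ∷ []

closing : Wedge → Edge
closing (u , v , w) = (v , w)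

mkWedge : Edge → Edge → Maybe Wedge
mkWedge (a , b) (c , d) =
  if ⌊ (a , b) ≟E (c , d) ⌋ then nothing
  else if a ≡ᵇ c then just (a , b ⊓ d , b ⊔ d)
  else if a ≡ᵇ d then just (a , b ⊓ c , b ⊔ c)
  else if b ≡ᵇ c then just (b , a ⊓ d , a ⊔ d)
  else if b ≡ᵇ d then just (b , a ⊓ c , a ⊔ c)
  else nothing

-- The algorithm only ever uses hash(e) through the event
-- hash(e) ≤ α and hash(w) through hash(w) ≤ β.  A "Hash" records these
-- bits: h (inj₁ e) = [hash(e) ≤ α], h (inj₂ w) = [hash(w) ≤ β].

Key : Set
Key = Edge ⊎ Wedge

_≟K_ : DecidableEquality Key
_≟K_ = ⊎-≡-dec _≟E_ _≟W_

Hash : Set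
Hash = Key → Bool

set : Key → Bool → Hash → Hash
set k b h k' = if ⌊ k' ≟K k ⌋ then b else h k'

-- Expectation of f over independent bits h k, k ∈ ks, with
-- Pr[h k = true] = p k  (keys not in ks are fixed to false; duplicate
-- keys in ks are harmless).
Exp : (Key → ℚ) → List Key → (Hash → ℚ) → ℚ
Exp p [] f = f (λ _ → false)
Exp p (k ∷ ks) f =
  p k ℚ.* Exp p ks (λ h → f (set k true h))
  ℚ.+ (1ℚ ℚ.- p k) ℚ.* Exp p ks (λ h → f (set k false h))

-- Pr[hash(e) ≤ α] = α, Pr[hash(w) ≤ β] = β for uniform hash values in (0,1)
prob : ℚ → ℚ → Key → ℚ
prob α β (inj₁ _) = α
prob α β (inj₂ _) = β

-- all keys the algorithm can ever query on the stream s
keys : List (ℕ × ℕ) → List Key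
keys s = map inj₁ es ++ map inj₂ (mapMaybe (λ p → mkWedge (proj₁ p) (proj₂ p)) (cartesianProduct es es))
  where es = map norm s

record State : Set where
  constructor st
  field
    eList : List Edge
    wList : List (Wedge × Bool)
open State public

addWedges : Hash → Edge → List Edge → List (Wedge × Bool) → List (Wedge × Bool)
addWedges h e [] wl = wl
addWedges h e (f ∷ fs) wl with mkWedge f e
... | nothing = addWedges h e fs wl
... | just w  = addWedges h e fs
      (if h (inj₂ w) ∧ not (w ∈?W map proj₁ wl) then wl ++ [ (w , false) ] else wl)

updX : Edge → Wedge × Bool → Wedge × Bool
updX e (w , X) =
  if ⌊ e ≟E closing w ⌋ then (w , true)
  else if e ∈?E wedgeEdges w then (w , false)
  else (w , X)

step : Hash → State → Edge → State
step h (st el wl) e with h (inj₁ e) ∧ not (e ∈?E el)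
... | true  = st (e ∷ el) (map (updX e) (addWedges h e el wl))
... | false = st el (map (updX e) wl)

runTo : Hash → List (ℕ × ℕ) → ℕ → State
runTo h s t = foldl (step h) (st [] []) (map norm (take t s))

-- edge list of G_t = G[max(1, t - Δt), t]  (1-indexed stream positions)
window : ℕ → ℕ → List (ℕ × ℕ) → List Edge
window Δt t s = map norm (drop ((1 ⊔ (t ∸ Δt)) ∸ 1) (take t s))

-- inverse of a rational (0 ↦ 0)
inv : ℚ → ℚ
inv p with p ℚ.≟ 0ℚ
... | yes _ = 0ℚ
... | no p≢0 = ℚ.1/_ p {{ℚ.≢-nonZero p≢0}}

countTrue : List Bool → ℕ
countTrue [] = 0
countTrue (true ∷ bs) = ℕ.suc (countTrue bs)
countTrue (false ∷ bs) = countTrue bs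

That : ℚ → ℚ → ℕ → List (ℕ × ℕ) → ℕ → Hash → ℚ
That α β Δt s t h =
  inv (α ℚ.* α ℚ.* β) ℚ.* ((+ countTrue (map (λ wX → proj₂ wX ∧ inG (proj₁ wX)) (wList (runTo h s t)))) / 1)
  where
    G = window Δt t s
    inG : Wedge → Bool
    inG w = norm (proj₁ w , proj₁ (proj₂ w)) ∈?E G
            ∧ norm (proj₁ w , proj₂ (proj₂ w)) ∈?E G

IsTriangle : List Edge → ℕ × ℕ × ℕ → Set
IsTriangle G (a , b , c) =
  a ℕ.< b × b ℕ.< c × (a , b) ∈ G × (b , c) ∈ G × (a , c) ∈ G

module Submission where

-- The bit X_w of a wedge in the w-list is a deterministic function of the
-- stream: it is 1 iff, among the three edges of w, the one that occurred last
-- is the closing edge.  So \hat T_t counts w iff both legs of w and w itself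
-- are sampled, both legs lie in G_t and the closing edge occurred after them;
-- then the closing edge lies in G_t as well, i.e. w is a corner of a triangle
-- of G_t.  Of the three corners of a triangle exactly one has this property
-- (the one opposite the edge seen last), and it is counted with probability
-- α²β, so linearity of expectation gives E[\hat T_t] = |T_t|.

open import Defs

open import Data.Bool using (Bool; true; false; _∧_; not; T)
open import Data.Bool.ListAction using (any)
open import Data.Bool.Properties using (T-≡; T?)
open import Data.Empty using (⊥-elim)
open import Data.Integer using (+_)
open import Data.List
  using (List; []; _∷_; _++_; [_]; map; length; foldr; foldl; reverse; take; drop; concatMap; mapMaybe; filter)
import Data.List.Properties as List
open import Data.List.Membership.Propositional using (_∈_; _∉_; find)
open import Data.List.Membership.Propositional.Properties
  using ( ∈-map⁺; ∈-map⁻; ∈-++⁺ˡ; ∈-++⁺ʳ; ∈-++⁻; ∈-cartesianProduct⁺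
        ; ∈-filter⁺; ∈-filter⁻; ∈-concatMap⁺; ∈-concatMap⁻)
open import Data.List.Membership.Propositional.Properties.WithK using (unique∧set⇒bag)
open import Data.List.Relation.Binary.BagAndSetEquality using (∼bag⇒↭)
open import Data.List.Relation.Binary.Permutation.Propositional.Properties using (↭-length)
open import Data.List.Relation.Unary.All as All using (All; []; _∷_)
open import Data.List.Relation.Unary.AllPairs using ([]; _∷_)
open import Data.List.Relation.Unary.Any as Any using (Any; here; there)
import Data.List.Relation.Unary.Any.Properties as AnyP
open import Data.List.Relation.Unary.Unique.Propositional using (Unique)
import Data.List.Relation.Unary.Unique.Propositional.Properties as Unique
open import Data.Maybe using (Maybe; just; nothing)
open import Data.Maybe.Properties using (just-injective)
import Data.Maybe.Relation.Unary.Any as MAny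
open import Data.Nat as ℕ using (ℕ; zero; suc; _<_; _≤_; _⊓_; _⊔_; _∸_; _≡ᵇ_)
import Data.Nat.Coprimality as Coprime
import Data.Nat.Properties as ℕ
open import Data.Product using (_×_; _,_; proj₁; proj₂; ∃)
open import Data.Rational as ℚ using (ℚ; 0ℚ; 1ℚ; _/_)
import Data.Rational.Properties as ℚ
open import Data.Rational.Solver using (module +-*-Solver)
open import Data.Sum as Sum using (_⊎_; inj₁; inj₂; [_,_]′)
open import Data.Sum.Properties using (inj₁-injective)
open import Function.Base using (_∘_)
open import Function.Bundles using (_⇔_; mk⇔; Equivalence)
open import Relation.Binary.Definitions using (DecidableEquality; tri<; tri≈; tri>)
open import Relation.Binary.PropositionalEquality hiding ([_])
open import Relation.Nullary using (yes; no; ¬_; Dec)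
open import Relation.Nullary.Decidable using (⌊_⌋; toWitness; fromWitness)

𝟙 : Bool → ℚ
𝟙 true = 1ℚ
𝟙 false = 0ℚ

sumℚ : List ℚ → ℚ
sumℚ = foldr ℚ._+_ 0ℚ

set-≡ : ∀ k b h → set k b h k ≡ b
set-≡ k b h with k ≟K k
... | yes _ = refl
... | no k≢k = ⊥-elim (k≢k refl)

set-≢ : ∀ {j k} b h → j ≢ k → set j b h k ≡ h k
set-≢ {j} {k} b h j≢k with k ≟K j
... | yes k≡j = ⊥-elim (j≢k (sym k≡j))
... | no _ = refl

set-set : ∀ k b b′ h → set k b (set k b′ h) ≗ set k b h
set-set k b b′ h k′ with k′ ≟K k
... | yes _ = refl
... | no _ = refl

set-comm : ∀ {j k} → j ≢ k → ∀ b b′ h → set j b (set k b′ h) ≗ set k b′ (set j b h)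
set-comm {j} {k} j≢k b b′ h k′ with k′ ≟K j | k′ ≟K k
... | yes refl | yes refl = ⊥-elim (j≢k refl)
... | yes _ | no _ = refl
... | no _ | yes _ = refl
... | no _ | no _ = refl

set-cong : ∀ k b {h h′} → h ≗ h′ → set k b h ≗ set k b h′
set-cong k b h≗h′ k′ with k′ ≟K k
... | yes _ = refl
... | no _ = h≗h′ k′

Extensional : (Hash → Bool) → Set
Extensional g = ∀ {h h′} → h ≗ h′ → g h ≡ g h′

module Expectation (p : Key → ℚ) where

  open +-*-Solver

  mix : ℚ → ℚ → ℚ → ℚ
  mix q a b = q ℚ.* a ℚ.+ (1ℚ ℚ.- q) ℚ.* b

  mix-const : ∀ q c → mix q c c ≡ c
  mix-const = solve 2 (λ q c → q :* c :+ (con 1ℚ :- q) :* c := c) refl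

  mix-+ : ∀ q a b c d → mix q (a ℚ.+ b) (c ℚ.+ d) ≡ mix q a c ℚ.+ mix q b d
  mix-+ = solve 5 (λ q a b c d → q :* (a :+ b) :+ (con 1ℚ :- q) :* (c :+ d)
                               := (q :* a :+ (con 1ℚ :- q) :* c) :+ (q :* b :+ (con 1ℚ :- q) :* d)) refl

  mix-* : ∀ q c a b → mix q (c ℚ.* a) (c ℚ.* b) ≡ c ℚ.* mix q a b
  mix-* = solve 4 (λ q c a b → q :* (c :* a) :+ (con 1ℚ :- q) :* (c :* b)
                             := c :* (q :* a :+ (con 1ℚ :- q) :* b)) refl

  mix-0ʳ : ∀ q a → mix q a 0ℚ ≡ q ℚ.* a
  mix-0ʳ = solve 2 (λ q a → q :* a :+ (con 1ℚ :- q) :* con 0ℚ := q :* a) refl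

  Exp-cong : ∀ ks {f g : Hash → ℚ} → (∀ h → f h ≡ g h) → Exp p ks f ≡ Exp p ks g
  Exp-cong [] f≗g = f≗g _
  Exp-cong (k ∷ ks) f≗g = cong₂ (mix (p k))
    (Exp-cong ks (λ h → f≗g (set k true h))) (Exp-cong ks (λ h → f≗g (set k false h)))

  Exp-const : ∀ ks c → Exp p ks (λ _ → c) ≡ c
  Exp-const [] c = refl
  Exp-const (k ∷ ks) c rewrite Exp-const ks c = mix-const (p k) c

  Exp-+ : ∀ ks (f g : Hash → ℚ) → Exp p ks (λ h → f h ℚ.+ g h) ≡ Exp p ks f ℚ.+ Exp p ks g
  Exp-+ [] f g = refl
  Exp-+ (k ∷ ks) f g
    rewrite Exp-+ ks (λ h → f (set k true h)) (λ h → g (set k true h))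
          | Exp-+ ks (λ h → f (set k false h)) (λ h → g (set k false h)) = mix-+ (p k) _ _ _ _

  Exp-* : ∀ ks c (f : Hash → ℚ) → Exp p ks (λ h → c ℚ.* f h) ≡ c ℚ.* Exp p ks f
  Exp-* [] c f = refl
  Exp-* (k ∷ ks) c f
    rewrite Exp-* ks c (λ h → f (set k true h))
          | Exp-* ks c (λ h → f (set k false h)) = mix-* (p k) c _ _

  Exp-sum : ∀ ks {A : Set} (xs : List A) (F : A → Hash → ℚ) →
            Exp p ks (λ h → sumℚ (map (λ x → F x h) xs)) ≡ sumℚ (map (λ x → Exp p ks (F x)) xs)
  Exp-sum ks [] F = Exp-const ks 0ℚ
  Exp-sum ks (x ∷ xs) F =
    trans (Exp-+ ks (F x) (λ h → sumℚ (map (λ y → F y h) xs)))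
          (cong (Exp p ks (F x) ℚ.+_) (Exp-sum ks xs F))

  Exp-sampled : ∀ ks {k} → k ∈ ks → (g : Hash → Bool) → Extensional g →
                Exp p ks (λ h → 𝟙 (h k ∧ g h)) ≡ p k ℚ.* Exp p ks (λ h → 𝟙 (g (set k true h)))
  Exp-sampled (j ∷ ks) {k} k∈ g g-ext with j ≟K k
  Exp-sampled (j ∷ ks) {j} k∈ g g-ext | yes refl = begin
    mix (p j) (Exp p ks (λ h → 𝟙 (set j true h j ∧ g (set j true h))))
              (Exp p ks (λ h → 𝟙 (set j false h j ∧ g (set j false h))))
      ≡⟨ cong₂ (mix (p j))
           (Exp-cong ks (λ h → cong (λ b → 𝟙 (b ∧ g (set j true h))) (set-≡ j true h)))
           (trans (Exp-cong ks (λ h → cong (λ b → 𝟙 (b ∧ g (set j false h))) (set-≡ j false h)))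
                  (Exp-const ks 0ℚ)) ⟩
    mix (p j) (Exp p ks (λ h → 𝟙 (g (set j true h)))) 0ℚ
      ≡⟨ mix-0ʳ (p j) _ ⟩
    p j ℚ.* Exp p ks (λ h → 𝟙 (g (set j true h)))
      ≡⟨ cong (p j ℚ.*_) (mix-const (p j) _) ⟨
    p j ℚ.* mix (p j) (Exp p ks (λ h → 𝟙 (g (set j true h)))) (Exp p ks (λ h → 𝟙 (g (set j true h))))
      ≡⟨ cong (p j ℚ.*_) (cong₂ (mix (p j))
           (Exp-cong ks (λ h → cong 𝟙 (g-ext (λ k′ → sym (set-set j true true h k′)))))
           (Exp-cong ks (λ h → cong 𝟙 (g-ext (λ k′ → sym (set-set j true false h k′)))))) ⟩
    p j ℚ.* mix (p j) (Exp p ks (λ h → 𝟙 (g (set j true (set j true h)))))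
                      (Exp p ks (λ h → 𝟙 (g (set j true (set j false h)))))
      ∎
    where open ≡-Reasoning
  Exp-sampled (j ∷ ks) (here k≡j) g g-ext | no j≢k = ⊥-elim (j≢k (sym k≡j))
  Exp-sampled (j ∷ ks) {k} (there k∈) g g-ext | no j≢k = begin
    mix (p j) (Exp p ks (λ h → 𝟙 (set j true h k ∧ g (set j true h))))
              (Exp p ks (λ h → 𝟙 (set j false h k ∧ g (set j false h))))
      ≡⟨ cong₂ (mix (p j)) (pass true) (pass false) ⟩
    mix (p j) (p k ℚ.* Exp p ks (λ h → 𝟙 (g (set j true (set k true h)))))
              (p k ℚ.* Exp p ks (λ h → 𝟙 (g (set j false (set k true h)))))
      ≡⟨ mix-* (p j) (p k) _ _ ⟩
    p k ℚ.* mix (p j) (Exp p ks (λ h → 𝟙 (g (set j true (set k true h)))))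
                      (Exp p ks (λ h → 𝟙 (g (set j false (set k true h)))))
      ≡⟨ cong (p k ℚ.*_) (cong₂ (mix (p j)) (swap true) (swap false)) ⟩
    p k ℚ.* mix (p j) (Exp p ks (λ h → 𝟙 (g (set k true (set j true h)))))
                      (Exp p ks (λ h → 𝟙 (g (set k true (set j false h)))))
      ∎
    where
      open ≡-Reasoning
      pass : ∀ b → Exp p ks (λ h → 𝟙 (set j b h k ∧ g (set j b h)))
                 ≡ p k ℚ.* Exp p ks (λ h → 𝟙 (g (set j b (set k true h))))
      pass b = trans (Exp-cong ks (λ h → cong (λ x → 𝟙 (x ∧ g (set j b h))) (set-≢ b h j≢k)))
                     (Exp-sampled ks k∈ (λ h → g (set j b h)) (λ h≗h′ → g-ext (set-cong j b h≗h′)))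
      swap : ∀ b → Exp p ks (λ h → 𝟙 (g (set j b (set k true h))))
                 ≡ Exp p ks (λ h → 𝟙 (g (set k true (set j b h))))
      swap b = Exp-cong ks (λ h → cong 𝟙 (g-ext (set-comm j≢k b true h)))

  Exp-three-sampled : ∀ ks {k₁ k₂ k₃} → k₁ ∈ ks → k₂ ∈ ks → k₃ ∈ ks →
                      k₁ ≢ k₂ → k₁ ≢ k₃ → k₂ ≢ k₃ → ∀ b →
                      Exp p ks (λ h → 𝟙 (h k₁ ∧ (h k₂ ∧ (h k₃ ∧ b))))
                        ≡ p k₁ ℚ.* (p k₂ ℚ.* (p k₃ ℚ.* 𝟙 b))
  Exp-three-sampled ks {k₁} {k₂} {k₃} k₁∈ k₂∈ k₃∈ k₁≢k₂ k₁≢k₃ k₂≢k₃ b = begin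
    Exp p ks (λ h → 𝟙 (h k₁ ∧ (h k₂ ∧ (h k₃ ∧ b))))
      ≡⟨ Exp-sampled ks k₁∈ (λ h → h k₂ ∧ (h k₃ ∧ b))
           (λ h≗h′ → cong₂ (λ x y → x ∧ (y ∧ b)) (h≗h′ k₂) (h≗h′ k₃)) ⟩
    p k₁ ℚ.* Exp p ks (λ h → 𝟙 (set k₁ true h k₂ ∧ (set k₁ true h k₃ ∧ b)))
      ≡⟨ cong (p k₁ ℚ.*_) (Exp-cong ks (λ h → cong 𝟙
           (cong₂ (λ x y → x ∧ (y ∧ b)) (set-≢ true h k₁≢k₂) (set-≢ true h k₁≢k₃)))) ⟩
    p k₁ ℚ.* Exp p ks (λ h → 𝟙 (h k₂ ∧ (h k₃ ∧ b)))
      ≡⟨ cong (p k₁ ℚ.*_) (Exp-sampled ks k₂∈ (λ h → h k₃ ∧ b) (λ h≗h′ → cong (_∧ b) (h≗h′ k₃))) ⟩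
    p k₁ ℚ.* (p k₂ ℚ.* Exp p ks (λ h → 𝟙 (set k₂ true h k₃ ∧ b)))
      ≡⟨ cong (λ x → p k₁ ℚ.* (p k₂ ℚ.* x))
           (Exp-cong ks (λ h → cong (λ x → 𝟙 (x ∧ b)) (set-≢ true h k₂≢k₃))) ⟩
    p k₁ ℚ.* (p k₂ ℚ.* Exp p ks (λ h → 𝟙 (h k₃ ∧ b)))
      ≡⟨ cong (λ x → p k₁ ℚ.* (p k₂ ℚ.* x)) (Exp-sampled ks k₃∈ (λ _ → b) (λ _ → refl)) ⟩
    p k₁ ℚ.* (p k₂ ℚ.* (p k₃ ℚ.* Exp p ks (λ _ → 𝟙 b)))
      ≡⟨ cong (λ x → p k₁ ℚ.* (p k₂ ℚ.* (p k₃ ℚ.* x))) (Exp-const ks (𝟙 b)) ⟩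
    p k₁ ℚ.* (p k₂ ℚ.* (p k₃ ℚ.* 𝟙 b))
      ∎
    where open ≡-Reasoning

fromℕ-suc : ∀ n → (+ suc n) / 1 ≡ 1ℚ ℚ.+ (+ n) / 1
fromℕ-suc zero = refl
fromℕ-suc (suc n) rewrite ℚ.normalize-coprime (Coprime.sym (Coprime.1-coprimeTo (suc n))) =
  sym (cong (λ k → (+ suc (suc k)) / 1) (ℕ.*-identityʳ n))

countTrue-sum : ∀ {A : Set} (F : A → Bool) xs → (+ countTrue (map F xs)) / 1 ≡ sumℚ (map (λ x → 𝟙 (F x)) xs)
countTrue-sum F [] = refl
countTrue-sum F (x ∷ xs) with F x
... | true = trans (fromℕ-suc (countTrue (map F xs))) (cong (1ℚ ℚ.+_) (countTrue-sum F xs))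
... | false = trans (sym (ℚ.+-identityˡ ((+ countTrue (map F xs)) / 1))) (cong (0ℚ ℚ.+_) (countTrue-sum F xs))

sumℚ-cong : ∀ {A : Set} (f g : A → ℚ) xs → (∀ x → x ∈ xs → f x ≡ g x) →
            sumℚ (map f xs) ≡ sumℚ (map g xs)
sumℚ-cong f g [] eq = refl
sumℚ-cong f g (x ∷ xs) eq = cong₂ ℚ._+_ (eq x (here refl)) (sumℚ-cong f g xs (λ y m → eq y (there m)))

sumℚ-++ : ∀ {A : Set} (f : A → ℚ) xs ys → sumℚ (map f (xs ++ ys)) ≡ sumℚ (map f xs) ℚ.+ sumℚ (map f ys)
sumℚ-++ f [] ys = sym (ℚ.+-identityˡ _)
sumℚ-++ f (x ∷ xs) ys rewrite sumℚ-++ f xs ys = sym (ℚ.+-assoc (f x) _ _)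

sumℚ-* : ∀ {A : Set} (c : ℚ) (f : A → ℚ) xs → sumℚ (map (λ x → c ℚ.* f x) xs) ≡ c ℚ.* sumℚ (map f xs)
sumℚ-* c f [] = sym (ℚ.*-zeroʳ c)
sumℚ-* c f (x ∷ xs) rewrite sumℚ-* c f xs = sym (ℚ.*-distribˡ-+ c (f x) _)

countTrue-filter : ∀ {A : Set} (F : A → Bool) xs → countTrue (map F xs) ≡ length (filter (λ x → T? (F x)) xs)
countTrue-filter F [] = refl
countTrue-filter F (x ∷ xs) with F x
... | true = cong suc (countTrue-filter F xs)
... | false = countTrue-filter F xs

countTrue-cong : ∀ {A : Set} (F G : A → Bool) xs → (∀ {x} → x ∈ xs → F x ≡ G x) →
                 countTrue (map F xs) ≡ countTrue (map G xs)
countTrue-cong F G [] _ = refl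
countTrue-cong F G (x ∷ xs) F≡G rewrite F≡G (here refl) with G x
... | true = cong suc (countTrue-cong F G xs (λ x∈ → F≡G (there x∈)))
... | false = countTrue-cong F G xs (λ x∈ → F≡G (there x∈))

countTrue-unique : ∀ {A : Set} (F G : A → Bool) xs ys → Unique xs → Unique ys →
                   (∀ {x} → x ∈ xs → F x ≡ true → x ∈ ys × G x ≡ true) →
                   (∀ {x} → x ∈ ys → G x ≡ true → x ∈ xs × F x ≡ true) →
                   countTrue (map F xs) ≡ countTrue (map G ys)
countTrue-unique {A} F G xs ys xs-unique ys-unique to from = begin
  countTrue (map F xs)                     ≡⟨ countTrue-filter F xs ⟩
  length (filter (λ x → T? (F x)) xs)      ≡⟨ ↭-length (∼bag⇒↭ (unique∧set⇒bag
                                                (Unique.filter⁺ _ xs-unique) (Unique.filter⁺ _ ys-unique) same)) ⟩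
  length (filter (λ x → T? (G x)) ys)      ≡⟨ countTrue-filter G ys ⟨
  countTrue (map G ys)                     ∎
  where
    open ≡-Reasoning
    across : ∀ {F G : A → Bool} {xs ys} → (∀ {x} → x ∈ xs → F x ≡ true → x ∈ ys × G x ≡ true) →
             ∀ {x} → x ∈ filter (λ x → T? (F x)) xs → x ∈ filter (λ x → T? (G x)) ys
    across {F} {G} {xs} {ys} to′ x∈ with ∈-filter⁻ (λ x → T? (F x)) x∈
    ... | x∈xs , Fx with to′ x∈xs (Equivalence.to T-≡ Fx)
    ...   | x∈ys , Gx = ∈-filter⁺ (λ x → T? (G x)) x∈ys (Equivalence.from T-≡ Gx)
    same : ∀ {x} → x ∈ filter (λ x → T? (F x)) xs ⇔ x ∈ filter (λ x → T? (G x)) ys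
    same = mk⇔ (across to) (across from)

m<n⇒m⊓n≡m : ∀ {m n} → m < n → m ⊓ n ≡ m
m<n⇒m⊓n≡m m<n = ℕ.m≤n⇒m⊓n≡m (ℕ.<⇒≤ m<n)

m<n⇒m⊔n≡n : ∀ {m n} → m < n → m ⊔ n ≡ n
m<n⇒m⊔n≡n m<n = ℕ.m≤n⇒m⊔n≡n (ℕ.<⇒≤ m<n)

m>n⇒m⊓n≡n : ∀ {m n} → n < m → m ⊓ n ≡ n
m>n⇒m⊓n≡n n<m = ℕ.m≥n⇒m⊓n≡n (ℕ.<⇒≤ n<m)

m>n⇒m⊔n≡m : ∀ {m n} → n < m → m ⊔ n ≡ m
m>n⇒m⊔n≡m n<m = ℕ.m≥n⇒m⊔n≡m (ℕ.<⇒≤ n<m)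

norm-< : ∀ {u v} → u < v → norm (u , v) ≡ (u , v)
norm-< u<v = cong₂ _,_ (m<n⇒m⊓n≡m u<v) (m<n⇒m⊔n≡n u<v)

norm-> : ∀ {u v} → v < u → norm (u , v) ≡ (v , u)
norm-> v<u = cong₂ _,_ (m>n⇒m⊓n≡n v<u) (m>n⇒m⊔n≡m v<u)

Canonical : Edge → Set
Canonical (u , v) = u < v

norm-canonical : ∀ u v → u ≢ v → Canonical (norm (u , v))
norm-canonical u v u≢v with ℕ.<-cmp u v
... | tri< u<v _ _ = subst Canonical (sym (norm-< u<v)) u<v
... | tri≈ _ u≡v _ = ⊥-elim (u≢v u≡v)
... | tri> _ _ v<u = subst Canonical (sym (norm-> v<u)) v<u

,-≢ˡ : ∀ {a b c d : ℕ} → a ≢ c → (a , b) ≢ (c , d)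
,-≢ˡ a≢c refl = a≢c refl

,-≢ʳ : ∀ {a b c d : ℕ} → b ≢ d → (a , b) ≢ (c , d)
,-≢ʳ b≢d refl = b≢d refl

≟E-refl : ∀ (e : Edge) → ⌊ e ≟E e ⌋ ≡ true
≟E-refl e with e ≟E e
... | yes _ = refl
... | no e≢e = ⊥-elim (e≢e refl)

≟E-≢ : ∀ {e f : Edge} → e ≢ f → ⌊ e ≟E f ⌋ ≡ false
≟E-≢ {e} {f} e≢f with e ≟E f
... | yes e≡f = ⊥-elim (e≢f e≡f)
... | no _ = refl

≡ᵇ-refl : ∀ n → (n ≡ᵇ n) ≡ true
≡ᵇ-refl n = Equivalence.to T-≡ (ℕ.≡⇒≡ᵇ n n refl)

≡ᵇ-true⇒≡ : ∀ m n → (m ≡ᵇ n) ≡ true → m ≡ n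
≡ᵇ-true⇒≡ m n eq = ℕ.≡ᵇ⇒≡ m n (Equivalence.from T-≡ eq)

≡ᵇ-≢ : ∀ {m n} → m ≢ n → (m ≡ᵇ n) ≡ false
≡ᵇ-≢ {m} {n} m≢n with m ≡ᵇ n in eq
... | true = ⊥-elim (m≢n (≡ᵇ-true⇒≡ m n eq))
... | false = refl

≡ᵇ-false⇒≢ : ∀ m n → (m ≡ᵇ n) ≡ false → m ≢ n
≡ᵇ-false⇒≢ m n eq m≡n = subst T eq (ℕ.≡⇒≡ᵇ m n m≡n)

leg₁ leg₂ : Wedge → Edge
leg₁ (u , v , _) = norm (u , v)
leg₂ (u , _ , w) = norm (u , w)

edgeAB edgeBC edgeAC : ℕ × ℕ × ℕ → Edge
edgeAB (a , b , c) = (a , b)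
edgeBC (a , b , c) = (b , c)
edgeAC (a , b , c) = (a , c)

data Corner : ℕ × ℕ × ℕ → Wedge → Set where
  cornerA : ∀ {a b c} → a < b → b < c → Corner (a , b , c) (a , b , c)
  cornerB : ∀ {a b c} → a < b → b < c → Corner (a , b , c) (b , a , c)
  cornerC : ∀ {a b c} → a < b → b < c → Corner (a , b , c) (c , a , b)

Sorted : ℕ × ℕ × ℕ → Set
Sorted (a , b , c) = a < b × b < c

corner-sorted : ∀ {τ w} → Corner τ w → Sorted τ
corner-sorted (cornerA a<b b<c) = a<b , b<c
corner-sorted (cornerB a<b b<c) = a<b , b<c
corner-sorted (cornerC a<b b<c) = a<b , b<c

corner-unique : ∀ {τ τ′ w} → Corner τ w → Corner τ′ w → τ ≡ τ′
corner-unique (cornerA _ _) (cornerA _ _) = refl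
corner-unique (cornerA a<b _) (cornerB a<b′ _) = ⊥-elim (ℕ.<-asym a<b a<b′)
corner-unique (cornerA a<b _) (cornerC a<b′ b<c′) = ⊥-elim (ℕ.<-asym a<b (ℕ.<-trans a<b′ b<c′))
corner-unique (cornerB a<b _) (cornerA a<b′ _) = ⊥-elim (ℕ.<-asym a<b a<b′)
corner-unique (cornerB _ _) (cornerB _ _) = refl
corner-unique (cornerB _ b<c) (cornerC _ b<c′) = ⊥-elim (ℕ.<-asym b<c b<c′)
corner-unique (cornerC a<b b<c) (cornerA a<b′ _) = ⊥-elim (ℕ.<-asym a<b′ (ℕ.<-trans a<b b<c))
corner-unique (cornerC _ b<c) (cornerB _ b<c′) = ⊥-elim (ℕ.<-asym b<c b<c′)
corner-unique (cornerC _ _) (cornerC _ _) = refl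

triangle⇒corner-edges : ∀ {τ w} → Corner τ w → (P : Edge → Set) →
                        P (edgeAB τ) → P (edgeBC τ) → P (edgeAC τ) →
                        P (closing w) × P (leg₁ w) × P (leg₂ w)
triangle⇒corner-edges (cornerA a<b b<c) P pab pbc pac
  rewrite norm-< a<b | norm-< (ℕ.<-trans a<b b<c) = pbc , pab , pac
triangle⇒corner-edges (cornerB a<b b<c) P pab pbc pac
  rewrite norm-> a<b | norm-< b<c = pac , pab , pbc
triangle⇒corner-edges (cornerC a<b b<c) P pab pbc pac
  rewrite norm-> (ℕ.<-trans a<b b<c) | norm-> b<c = pab , pac , pbc

corner-edges⇒triangle : ∀ {τ w} → Corner τ w → (P : Edge → Set) →
                        P (closing w) → P (leg₁ w) → P (leg₂ w) →
                        P (edgeAB τ) × P (edgeBC τ) × P (edgeAC τ)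
corner-edges⇒triangle (cornerA a<b b<c) P pc p₁ p₂
  rewrite norm-< a<b | norm-< (ℕ.<-trans a<b b<c) = p₁ , pc , p₂
corner-edges⇒triangle (cornerB a<b b<c) P pc p₁ p₂
  rewrite norm-> a<b | norm-< b<c = p₁ , p₂ , pc
corner-edges⇒triangle (cornerC a<b b<c) P pc p₁ p₂
  rewrite norm-> (ℕ.<-trans a<b b<c) | norm-> b<c = pc , p₂ , p₁

corner-edges-distinct : ∀ {τ w} → Corner τ w → closing w ≢ leg₁ w × closing w ≢ leg₂ w × leg₁ w ≢ leg₂ w
corner-edges-distinct (cornerA a<b b<c) rewrite norm-< a<b | norm-< (ℕ.<-trans a<b b<c) =
  ,-≢ˡ (ℕ.>⇒≢ a<b) , ,-≢ˡ (ℕ.>⇒≢ a<b) , ,-≢ʳ (ℕ.<⇒≢ b<c)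
corner-edges-distinct (cornerB a<b b<c) rewrite norm-> a<b | norm-< b<c =
  ,-≢ʳ (ℕ.>⇒≢ b<c) , ,-≢ˡ (ℕ.<⇒≢ a<b) , ,-≢ˡ (ℕ.<⇒≢ a<b)
corner-edges-distinct (cornerC a<b b<c) rewrite norm-> (ℕ.<-trans a<b b<c) | norm-> b<c =
  ,-≢ʳ (ℕ.<⇒≢ b<c) , ,-≢ˡ (ℕ.<⇒≢ a<b) , ,-≢ˡ (ℕ.<⇒≢ a<b)

corners : ℕ × ℕ × ℕ → List Wedge
corners (a , b , c) = (a , b , c) ∷ (b , a , c) ∷ (c , a , b) ∷ []

∈-corners⇒Corner : ∀ {τ w} → Sorted τ → w ∈ corners τ → Corner τ w
∈-corners⇒Corner (a<b , b<c) (here refl) = cornerA a<b b<c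
∈-corners⇒Corner (a<b , b<c) (there (here refl)) = cornerB a<b b<c
∈-corners⇒Corner (a<b , b<c) (there (there (here refl))) = cornerC a<b b<c

Corner⇒∈-corners : ∀ {τ w} → Corner τ w → w ∈ corners τ
Corner⇒∈-corners (cornerA _ _) = here refl
Corner⇒∈-corners (cornerB _ _) = there (here refl)
Corner⇒∈-corners (cornerC _ _) = there (there (here refl))

corners-unique : ∀ {τ} → Sorted τ → Unique (corners τ)
corners-unique (a<b , b<c) =
  (centre-≢ (ℕ.<⇒≢ a<b) ∷ centre-≢ (ℕ.<⇒≢ (ℕ.<-trans a<b b<c)) ∷ []) ∷
  (centre-≢ (ℕ.<⇒≢ b<c) ∷ []) ∷ [] ∷ []
  where
    centre-≢ : ∀ {u u′ : ℕ} {r r′ : Edge} → u ≢ u′ → (u , r) ≢ (u′ , r′)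
    centre-≢ u≢u′ refl = u≢u′ refl

cornersOf : List (ℕ × ℕ × ℕ) → List Wedge
cornersOf = concatMap corners

∈-cornersOf⁻ : ∀ {Ts w} → (∀ {τ} → τ ∈ Ts → Sorted τ) → w ∈ cornersOf Ts →
               ∃ λ τ → τ ∈ Ts × Corner τ w
∈-cornersOf⁻ {Ts} Ts-sorted w∈ with find (∈-concatMap⁻ corners {xs = Ts} w∈)
... | τ , τ∈ , w∈τ = τ , τ∈ , ∈-corners⇒Corner (Ts-sorted τ∈) w∈τ

∈-cornersOf⁺ : ∀ {Ts τ w} → τ ∈ Ts → Corner τ w → w ∈ cornersOf Ts
∈-cornersOf⁺ τ∈ corner = ∈-concatMap⁺ corners (Any.map (λ { refl → Corner⇒∈-corners corner }) τ∈)

cornersOf-unique : ∀ {Ts} → Unique Ts → (∀ {τ} → τ ∈ Ts → Sorted τ) → Unique (cornersOf Ts)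
cornersOf-unique [] _ = []
cornersOf-unique {τ ∷ Ts} (τ∉Ts ∷ Ts-unique) Ts-sorted =
  Unique.++⁺ (corners-unique (Ts-sorted (here refl)))
             (cornersOf-unique Ts-unique (λ τ∈ → Ts-sorted (there τ∈))) disjoint
  where
    disjoint : ∀ {w} → ¬ (w ∈ corners τ × w ∈ cornersOf Ts)
    disjoint (w∈τ , w∈Ts) with ∈-cornersOf⁻ (λ τ∈ → Ts-sorted (there τ∈)) w∈Ts
    ... | τ′ , τ′∈ , corner′ =
      All.lookup τ∉Ts τ′∈ (corner-unique (∈-corners⇒Corner (Ts-sorted (here refl)) w∈τ) corner′)

mkWedge-corner : ∀ {τ w} → Corner τ w →
                 mkWedge (leg₁ w) (leg₂ w) ≡ just w × mkWedge (leg₂ w) (leg₁ w) ≡ just w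
mkWedge-corner (cornerA {a} {b} {c} a<b b<c) =
  subst₂ (λ x y → mkWedge x y ≡ just (a , b , c) × mkWedge y x ≡ just (a , b , c))
    (sym (norm-< a<b)) (sym (norm-< (ℕ.<-trans a<b b<c))) (legs , swapped)
  where
    legs : mkWedge (a , b) (a , c) ≡ just (a , b , c)
    legs rewrite ≟E-≢ (,-≢ʳ {a} {_} {a} (ℕ.<⇒≢ b<c)) | ≡ᵇ-refl a
               | m<n⇒m⊓n≡m b<c | m<n⇒m⊔n≡n b<c = refl
    swapped : mkWedge (a , c) (a , b) ≡ just (a , b , c)
    swapped rewrite ≟E-≢ (,-≢ʳ {a} {_} {a} (ℕ.>⇒≢ b<c)) | ≡ᵇ-refl a
                  | m>n⇒m⊓n≡n b<c | m>n⇒m⊔n≡m b<c = refl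
mkWedge-corner (cornerB {a} {b} {c} a<b b<c) =
  subst₂ (λ x y → mkWedge x y ≡ just (b , a , c) × mkWedge y x ≡ just (b , a , c))
    (sym (norm-> a<b)) (sym (norm-< b<c)) (legs , swapped)
  where
    a<c = ℕ.<-trans a<b b<c
    legs : mkWedge (a , b) (b , c) ≡ just (b , a , c)
    legs rewrite ≟E-≢ (,-≢ˡ {a} {b} {b} {c} (ℕ.<⇒≢ a<b)) | ≡ᵇ-≢ (ℕ.<⇒≢ a<b) | ≡ᵇ-≢ (ℕ.<⇒≢ a<c)
               | ≡ᵇ-refl b | m<n⇒m⊓n≡m a<c | m<n⇒m⊔n≡n a<c = refl
    swapped : mkWedge (b , c) (a , b) ≡ just (b , a , c)
    swapped rewrite ≟E-≢ (,-≢ˡ {b} {c} {a} {b} (ℕ.>⇒≢ a<b)) | ≡ᵇ-≢ (ℕ.>⇒≢ a<b)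
                  | ≡ᵇ-refl b | m>n⇒m⊓n≡n a<c | m>n⇒m⊔n≡m a<c = refl
mkWedge-corner (cornerC {a} {b} {c} a<b b<c) =
  subst₂ (λ x y → mkWedge x y ≡ just (c , a , b) × mkWedge y x ≡ just (c , a , b))
    (sym (norm-> (ℕ.<-trans a<b b<c))) (sym (norm-> b<c)) (legs , swapped)
  where
    a<c = ℕ.<-trans a<b b<c
    legs : mkWedge (a , c) (b , c) ≡ just (c , a , b)
    legs rewrite ≟E-≢ (,-≢ˡ {a} {c} {b} {c} (ℕ.<⇒≢ a<b)) | ≡ᵇ-≢ (ℕ.<⇒≢ a<b) | ≡ᵇ-≢ (ℕ.<⇒≢ a<c)
               | ≡ᵇ-≢ (ℕ.>⇒≢ b<c) | ≡ᵇ-refl c | m<n⇒m⊓n≡m a<b | m<n⇒m⊔n≡n a<b = refl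
    swapped : mkWedge (b , c) (a , c) ≡ just (c , a , b)
    swapped rewrite ≟E-≢ (,-≢ˡ {b} {c} {a} {c} (ℕ.>⇒≢ a<b)) | ≡ᵇ-≢ (ℕ.>⇒≢ a<b) | ≡ᵇ-≢ (ℕ.<⇒≢ b<c)
                  | ≡ᵇ-≢ (ℕ.>⇒≢ a<c) | ≡ᵇ-refl c | m>n⇒m⊓n≡n a<b | m>n⇒m⊔n≡m a<b = refl

HasLegs : Wedge → Edge → Edge → Set
HasLegs w f g = (leg₁ w ≡ f × leg₂ w ≡ g) ⊎ (leg₁ w ≡ g × leg₂ w ≡ f)

CornerWithLegs : Edge → Edge → Wedge → Set
CornerWithLegs f g w = ∃ λ τ → Corner τ w × HasLegs w f g

shared-lower-lower : ∀ {a b d} → a < b → a < d → b ≢ d → CornerWithLegs (a , b) (a , d) (a , b ⊓ d , b ⊔ d)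
shared-lower-lower {a} {b} {d} a<b a<d b≢d with ℕ.<-cmp b d
... | tri< b<d _ _ rewrite m<n⇒m⊓n≡m b<d | m<n⇒m⊔n≡n b<d = _ , cornerA a<b b<d , inj₁ (norm-< a<b , norm-< a<d)
... | tri≈ _ b≡d _ = ⊥-elim (b≢d b≡d)
... | tri> _ _ d<b rewrite m>n⇒m⊓n≡n d<b | m>n⇒m⊔n≡m d<b = _ , cornerA a<d d<b , inj₂ (norm-< a<d , norm-< a<b)

shared-lower-upper : ∀ {a b c} → c < a → a < b → CornerWithLegs (a , b) (c , a) (a , b ⊓ c , b ⊔ c)
shared-lower-upper c<a a<b rewrite m>n⇒m⊓n≡n (ℕ.<-trans c<a a<b) | m>n⇒m⊔n≡m (ℕ.<-trans c<a a<b) =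
  _ , cornerB c<a a<b , inj₂ (norm-> c<a , norm-< a<b)

shared-upper-lower : ∀ {a b d} → a < b → b < d → CornerWithLegs (a , b) (b , d) (b , a ⊓ d , a ⊔ d)
shared-upper-lower a<b b<d rewrite m<n⇒m⊓n≡m (ℕ.<-trans a<b b<d) | m<n⇒m⊔n≡n (ℕ.<-trans a<b b<d) =
  _ , cornerB a<b b<d , inj₁ (norm-> a<b , norm-< b<d)

shared-upper-upper : ∀ {a b c} → a < b → c < b → a ≢ c → CornerWithLegs (a , b) (c , b) (b , a ⊓ c , a ⊔ c)
shared-upper-upper {a} {b} {c} a<b c<b a≢c with ℕ.<-cmp a c
... | tri< a<c _ _ rewrite m<n⇒m⊓n≡m a<c | m<n⇒m⊔n≡n a<c = _ , cornerC a<c c<b , inj₁ (norm-> a<b , norm-> c<b)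
... | tri≈ _ a≡c _ = ⊥-elim (a≢c a≡c)
... | tri> _ _ c<a rewrite m>n⇒m⊓n≡n c<a | m>n⇒m⊔n≡m c<a = _ , cornerC c<a a<b , inj₂ (norm-> c<b , norm-> a<b)

mkWedge-sound : ∀ {f g w} → Canonical f → Canonical g → mkWedge f g ≡ just w → CornerWithLegs f g w
mkWedge-sound {a , b} {c , d} a<b c<d eq with (a , b) ≟E (c , d)
... | yes _ with eq
... | ()
mkWedge-sound {a , b} {c , d} a<b c<d eq | no ab≢cd with a ≡ᵇ c in a≟c
... | true with ≡ᵇ-true⇒≡ a c a≟c
... | refl = subst (CornerWithLegs _ _) (just-injective eq)
               (shared-lower-lower a<b c<d (λ b≡d → ab≢cd (cong (a ,_) b≡d)))
mkWedge-sound {a , b} {c , d} a<b c<d eq | no ab≢cd | false with a ≡ᵇ d in a≟d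
... | true with ≡ᵇ-true⇒≡ a d a≟d
... | refl = subst (CornerWithLegs _ _) (just-injective eq) (shared-lower-upper c<d a<b)
mkWedge-sound {a , b} {c , d} a<b c<d eq | no ab≢cd | false | false with b ≡ᵇ c in b≟c
... | true with ≡ᵇ-true⇒≡ b c b≟c
... | refl = subst (CornerWithLegs _ _) (just-injective eq) (shared-upper-lower a<b c<d)
mkWedge-sound {a , b} {c , d} a<b c<d eq | no ab≢cd | false | false | false with b ≡ᵇ d in b≟d
... | true with ≡ᵇ-true⇒≡ b d b≟d
... | refl = subst (CornerWithLegs _ _) (just-injective eq) (shared-upper-upper a<b c<d (≡ᵇ-false⇒≢ a c a≟c))
mkWedge-sound {a , b} {c , d} a<b c<d eq | no ab≢cd | false | false | false | false with eq
... | ()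

mkWedge-comm : ∀ {f g w} → Canonical f → Canonical g → mkWedge f g ≡ just w → mkWedge g f ≡ just w
mkWedge-comm {a , b} {c , d} {w} f-can g-can eq with mkWedge-sound f-can g-can eq
... | _ , corner , inj₁ (refl , refl) = proj₂ (mkWedge-corner corner)
... | _ , corner , inj₂ (refl , refl) = proj₁ (mkWedge-corner corner)

mkWedge-self : ∀ f → mkWedge f f ≡ nothing
mkWedge-self f rewrite ≟E-refl f = refl

mkWedge-second-leg : ∀ {f e w} → Canonical f → Canonical e → mkWedge f e ≡ just w →
                     (e ≡ leg₁ w ⊎ e ≡ leg₂ w) × e ≢ closing w
mkWedge-second-leg {a , b} {c , d} f-can e-can eq with mkWedge-sound f-can e-can eq
... | _ , corner , inj₁ (_ , refl) = inj₂ refl , λ e≡cl → proj₁ (proj₂ (corner-edges-distinct corner)) (sym e≡cl)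
... | _ , corner , inj₂ (refl , _) = inj₁ refl , λ e≡cl → proj₁ (corner-edges-distinct corner) (sym e≡cl)

updX-wedge : ∀ e x → proj₁ (updX e x) ≡ proj₁ x
updX-wedge e ((u , v , w) , X) with ⌊ e ≟E (v , w) ⌋
... | true = refl
... | false with e ∈?E wedgeEdges (u , v , w)
... | true = refl
... | false = refl

updX-closing : ∀ w X → proj₂ (updX (closing w) (w , X)) ≡ true
updX-closing (u , v , w) X rewrite ≟E-refl (v , w) = refl

updX-leg : ∀ {e} w X → e ≢ closing w → e ≡ leg₁ w ⊎ e ≡ leg₂ w → proj₂ (updX e (w , X)) ≡ false
updX-leg (u , v , w) X e≢cl (inj₁ refl) rewrite ≟E-≢ e≢cl | ≟E-refl (norm (u , v)) = refl
updX-leg (u , v , w) X e≢cl (inj₂ refl) rewrite ≟E-≢ e≢cl | ≟E-refl (norm (u , w))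
  with ⌊ norm (u , w) ≟E norm (u , v) ⌋
... | true = refl
... | false = refl

updX-other : ∀ {e} w X → e ≢ closing w → e ≢ leg₁ w → e ≢ leg₂ w → proj₂ (updX e (w , X)) ≡ X
updX-other (u , v , w) X e≢cl e≢leg₁ e≢leg₂ rewrite ≟E-≢ e≢cl | ≟E-≢ e≢leg₁ | ≟E-≢ e≢leg₂ = refl

-- The bit X_w after processing R, listed most recent first.  When w enters
-- the w-list is irrelevant: it enters together with one of its legs, which
-- resets the bit anyway.
closedBit : Wedge → List Edge → Bool
closedBit w = foldr (λ e X → proj₂ (updX e (w , X))) false

closedBit-closing∈ : ∀ w R₁ R₂ {e} → closedBit w (R₁ ++ R₂) ≡ true → e ∈ R₁ →
                     e ≡ leg₁ w ⊎ e ≡ leg₂ w → closing w ∈ R₁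
closedBit-closing∈ w (x ∷ R₁) R₂ {e} closed e∈ e-leg = go (x ≟E closing w) (x ≟E leg₁ w) (x ≟E leg₂ w) e∈
  where
    X = closedBit w (R₁ ++ R₂)
    go : Dec (x ≡ closing w) → Dec (x ≡ leg₁ w) → Dec (x ≡ leg₂ w) → e ∈ x ∷ R₁ → closing w ∈ x ∷ R₁
    go (yes x≡cl) _ _ _ = here (sym x≡cl)
    go (no x≢cl) (yes x≡leg) _ _ with trans (sym (updX-leg w X x≢cl (inj₁ x≡leg))) closed
    ... | ()
    go (no x≢cl) (no _) (yes x≡leg) _ with trans (sym (updX-leg w X x≢cl (inj₂ x≡leg))) closed
    ... | ()
    go (no _) (no x≢leg₁) (no x≢leg₂) (here refl) = ⊥-elim ([ x≢leg₁ , x≢leg₂ ]′ e-leg)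
    go (no x≢cl) (no x≢leg₁) (no x≢leg₂) (there e∈) =
      there (closedBit-closing∈ w R₁ R₂ (trans (sym (updX-other w X x≢cl x≢leg₁ x≢leg₂)) closed) e∈ e-leg)

data OneHot : Bool → Bool → Bool → Set where
  first : OneHot true false false
  second : OneHot false true false
  third : OneHot false false true

oneHot-sum : ∀ {x y z} → OneHot x y z → sumℚ (map 𝟙 (x ∷ y ∷ z ∷ [])) ≡ 1ℚ
oneHot-sum first = refl
oneHot-sum second = refl
oneHot-sum third = refl

record Spans (w : Wedge) (cl l₁ l₂ : Edge) : Set where
  field
    closing≡ : closing w ≡ cl
    leg₁≡ : leg₁ w ≡ l₁
    leg₂≡ : leg₂ w ≡ l₂
open Spans

≢-≡-trans : ∀ {A : Set} {x y z : A} → x ≢ y → y ≡ z → x ≢ z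
≢-≡-trans x≢y refl = x≢y

closedBit-oneHot : ∀ {wA wB wC X Y Z} → Spans wA Y X Z → Spans wB Z X Y → Spans wC X Z Y →
                   X ≢ Y → X ≢ Z → Y ≢ Z → ∀ R → X ∈ R ⊎ Y ∈ R ⊎ Z ∈ R →
                   OneHot (closedBit wA R) (closedBit wB R) (closedBit wC R)
closedBit-oneHot _ _ _ _ _ _ [] (inj₁ ())
closedBit-oneHot _ _ _ _ _ _ [] (inj₂ (inj₁ ()))
closedBit-oneHot _ _ _ _ _ _ [] (inj₂ (inj₂ ()))
closedBit-oneHot {wA} {wB} {wC} {X} {Y} {Z} A B C X≢Y X≢Z Y≢Z (e ∷ R) seen with e ≟E X | e ≟E Y | e ≟E Z
... | yes refl | _ | _
  rewrite updX-leg wA (closedBit wA R) (≢-≡-trans X≢Y (sym (closing≡ A))) (inj₁ (sym (leg₁≡ A)))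
        | updX-leg wB (closedBit wB R) (≢-≡-trans X≢Z (sym (closing≡ B))) (inj₁ (sym (leg₁≡ B)))
        | sym (closing≡ C) | updX-closing wC (closedBit wC R) = third
... | no _ | yes refl | _
  rewrite sym (closing≡ A) | updX-closing wA (closedBit wA R)
        | updX-leg wB (closedBit wB R) (≢-≡-trans Y≢Z (sym (closing≡ B))) (inj₂ (sym (leg₂≡ B)))
        | updX-leg wC (closedBit wC R) (≢-≡-trans (≢-sym X≢Y) (sym (closing≡ C))) (inj₂ (sym (leg₂≡ C))) = first
... | no _ | no _ | yes refl
  rewrite updX-leg wA (closedBit wA R) (≢-≡-trans (≢-sym Y≢Z) (sym (closing≡ A))) (inj₂ (sym (leg₂≡ A)))
        | sym (closing≡ B) | updX-closing wB (closedBit wB R)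
        | updX-leg wC (closedBit wC R) (≢-≡-trans (≢-sym X≢Z) (sym (closing≡ C))) (inj₁ (sym (leg₁≡ C))) = second
... | no e≢X | no e≢Y | no e≢Z
  rewrite updX-other wA (closedBit wA R) (≢-≡-trans e≢Y (sym (closing≡ A)))
                     (≢-≡-trans e≢X (sym (leg₁≡ A))) (≢-≡-trans e≢Z (sym (leg₂≡ A)))
        | updX-other wB (closedBit wB R) (≢-≡-trans e≢Z (sym (closing≡ B)))
                     (≢-≡-trans e≢X (sym (leg₁≡ B))) (≢-≡-trans e≢Y (sym (leg₂≡ B)))
        | updX-other wC (closedBit wC R) (≢-≡-trans e≢X (sym (closing≡ C)))
                     (≢-≡-trans e≢Z (sym (leg₁≡ C))) (≢-≡-trans e≢Y (sym (leg₂≡ C))) =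
  closedBit-oneHot A B C X≢Y X≢Z Y≢Z R (skip seen)
  where
    skip : X ∈ e ∷ R ⊎ Y ∈ e ∷ R ⊎ Z ∈ e ∷ R → X ∈ R ⊎ Y ∈ R ⊎ Z ∈ R
    skip (inj₁ (here refl)) = ⊥-elim (e≢X refl)
    skip (inj₁ (there m)) = inj₁ m
    skip (inj₂ (inj₁ (here refl))) = ⊥-elim (e≢Y refl)
    skip (inj₂ (inj₁ (there m))) = inj₂ (inj₁ m)
    skip (inj₂ (inj₂ (here refl))) = ⊥-elim (e≢Z refl)
    skip (inj₂ (inj₂ (there m))) = inj₂ (inj₂ m)

closedBit-corners : ∀ {a b c} → a < b → b < c → ∀ R → (a , b) ∈ R ⊎ (b , c) ∈ R ⊎ (a , c) ∈ R →
                    sumℚ (map (λ w → 𝟙 (closedBit w R)) (corners (a , b , c))) ≡ 1ℚ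
closedBit-corners a<b b<c R seen = oneHot-sum (closedBit-oneHot
  (record { closing≡ = refl ; leg₁≡ = norm-< a<b ; leg₂≡ = norm-< a<c })
  (record { closing≡ = refl ; leg₁≡ = norm-> a<b ; leg₂≡ = norm-< b<c })
  (record { closing≡ = refl ; leg₁≡ = norm-> a<c ; leg₂≡ = norm-> b<c })
  (,-≢ˡ (ℕ.<⇒≢ a<b)) (,-≢ʳ (ℕ.<⇒≢ b<c)) (,-≢ˡ (ℕ.>⇒≢ a<b)) R seen)
  where a<c = ℕ.<-trans a<b b<c

closedBit-cornersOf : ∀ Ts R → (∀ {τ} → τ ∈ Ts → Sorted τ × edgeAB τ ∈ R) →
                      sumℚ (map (λ w → 𝟙 (closedBit w R)) (cornersOf Ts)) ≡ (+ length Ts) / 1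
closedBit-cornersOf [] R _ = refl
closedBit-cornersOf ((a , b , c) ∷ Ts) R Ts-seen = begin
  sumℚ (map bit (corners (a , b , c) ++ cornersOf Ts))
    ≡⟨ sumℚ-++ bit (corners (a , b , c)) (cornersOf Ts) ⟩
  sumℚ (map bit (corners (a , b , c))) ℚ.+ sumℚ (map bit (cornersOf Ts))
    ≡⟨ cong₂ ℚ._+_ (closedBit-corners a<b b<c R (inj₁ ab∈R))
                   (closedBit-cornersOf Ts R (λ τ∈ → Ts-seen (there τ∈))) ⟩
  1ℚ ℚ.+ (+ length Ts) / 1
    ≡⟨ fromℕ-suc (length Ts) ⟨
  (+ suc (length Ts)) / 1
    ∎
  where
    open ≡-Reasoning
    bit = λ w → 𝟙 (closedBit w R)
    a<b = proj₁ (proj₁ (Ts-seen (here refl)))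
    b<c = proj₂ (proj₁ (Ts-seen (here refl)))
    ab∈R = proj₂ (Ts-seen (here refl))

module _ {A : Set} (_≟_ : DecidableEquality A) where

  any-≟-sound : ∀ {x} xs → any (λ y → ⌊ x ≟ y ⌋) xs ≡ true → x ∈ xs
  any-≟-sound xs found = Any.map toWitness (AnyP.any⁻ _ xs (Equivalence.from T-≡ found))

  any-≟-complete : ∀ {x xs} → x ∈ xs → any (λ y → ⌊ x ≟ y ⌋) xs ≡ true
  any-≟-complete x∈ = Equivalence.to T-≡ (AnyP.any⁺ _ (Any.map fromWitness x∈))

  any-≟-false⇒∉ : ∀ {x} xs → any (λ y → ⌊ x ≟ y ⌋) xs ≡ false → x ∉ xs
  any-≟-false⇒∉ xs absent x∈ with () ← trans (sym (any-≟-complete x∈)) absent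

∧-true : ∀ {x y} → x ∧ y ≡ true → x ≡ true × y ≡ true
∧-true {true} {true} _ = refl , refl

∧-true⁺ : ∀ {x y} → x ≡ true → y ≡ true → x ∧ y ≡ true
∧-true⁺ refl refl = refl

not-true : ∀ {x} → not x ≡ true → x ≡ false
not-true {false} _ = refl

∈-take : ∀ {A : Set} {x} n (xs : List A) → x ∈ take n xs → x ∈ xs
∈-take n xs x∈ = subst (_ ∈_) (List.take++drop≡id n xs) (∈-++⁺ˡ x∈)

∈-mapMaybe⁺ : ∀ {A B : Set} {f : A → Maybe B} {xs x y} → x ∈ xs → f x ≡ just y → y ∈ mapMaybe f xs
∈-mapMaybe⁺ {f = f} {xs} x∈ fx≡ =
  AnyP.mapMaybe⁺ f xs (AnyP.map⁺ (Any.map (λ { refl → subst (MAny.Any _) (sym fx≡) (MAny.just refl) }) x∈))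

Unique-snoc : ∀ {A : Set} {xs : List A} {x} → Unique xs → x ∉ xs → Unique (xs ++ [ x ])
Unique-snoc u x∉ = Unique.++⁺ u ([] ∷ []) λ { (x∈ , here refl) → x∉ x∈ }

wedges : List (Wedge × Bool) → List Wedge
wedges = map proj₁

wedges-snoc : ∀ wl w → wedges (wl ++ [ (w , false) ]) ≡ wedges wl ++ [ w ]
wedges-snoc wl w = List.map-++ proj₁ wl [ (w , false) ]

wedges-updX : ∀ e wl → wedges (map (updX e) wl) ≡ wedges wl
wedges-updX e wl = trans (sym (List.map-∘ wl)) (List.map-cong (updX-wedge e) wl)

module AddWedges (h : Hash) (e : Edge) where

  addWedges-unique : ∀ fs wl → Unique (wedges wl) → Unique (wedges (addWedges h e fs wl))
  addWedges-unique [] wl u = u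
  addWedges-unique (f ∷ fs) wl u with mkWedge f e
  ... | nothing = addWedges-unique fs wl u
  ... | just w with h (inj₂ w) ∧ not (w ∈?W wedges wl) in insert
  ... | false = addWedges-unique fs wl u
  ... | true = addWedges-unique fs (wl ++ [ (w , false) ])
      (subst Unique (sym (wedges-snoc wl w))
        (Unique-snoc u (any-≟-false⇒∉ _≟W_ (wedges wl) (not-true (proj₂ (∧-true insert))))))

  NewEntry : List Edge → Wedge × Bool → Set
  NewEntry fs (w , X) = X ≡ false × ∃ λ f → f ∈ fs × mkWedge f e ≡ just w × h (inj₂ w) ≡ true

  older : ∀ fs {f x} → NewEntry fs x → NewEntry (f ∷ fs) x
  older fs (X≡false , g , g∈ , made , sampled) = X≡false , g , there g∈ , made , sampled

  addWedges-∈⁻ : ∀ fs wl {x} → x ∈ addWedges h e fs wl → x ∈ wl ⊎ NewEntry fs x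
  addWedges-∈⁻ [] wl x∈ = inj₁ x∈
  addWedges-∈⁻ (f ∷ fs) wl x∈ with mkWedge f e in made
  ... | nothing = Sum.map₂ (older fs) (addWedges-∈⁻ fs wl x∈)
  ... | just w with h (inj₂ w) ∧ not (w ∈?W wedges wl) in insert
  ... | false = Sum.map₂ (older fs) (addWedges-∈⁻ fs wl x∈)
  ... | true with addWedges-∈⁻ fs (wl ++ [ (w , false) ]) x∈
  ...   | inj₂ new = inj₂ (older fs new)
  ...   | inj₁ x∈′ with ∈-++⁻ wl x∈′
  ...     | inj₁ x∈wl = inj₁ x∈wl
  ...     | inj₂ (here refl) = inj₂ (refl , f , here refl , made , proj₁ (∧-true insert))

  addWedges-keeps : ∀ fs wl {w} → w ∈ wedges wl → w ∈ wedges (addWedges h e fs wl)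
  addWedges-keeps [] wl w∈ = w∈
  addWedges-keeps (f ∷ fs) wl w∈ with mkWedge f e
  ... | nothing = addWedges-keeps fs wl w∈
  ... | just w′ with h (inj₂ w′) ∧ not (w′ ∈?W wedges wl)
  ... | false = addWedges-keeps fs wl w∈
  ... | true = addWedges-keeps fs (wl ++ [ (w′ , false) ])
      (subst (_ ∈_) (sym (wedges-snoc wl w′)) (∈-++⁺ˡ w∈))

  addWedges-adds : ∀ fs wl {f w} → f ∈ fs → mkWedge f e ≡ just w → h (inj₂ w) ≡ true →
                   w ∈ wedges (addWedges h e fs wl)
  addWedges-adds (f′ ∷ fs) wl (there f∈) made sampled with mkWedge f′ e
  ... | nothing = addWedges-adds fs wl f∈ made sampled
  ... | just w′ with h (inj₂ w′) ∧ not (w′ ∈?W wedges wl)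
  ... | false = addWedges-adds fs wl f∈ made sampled
  ... | true = addWedges-adds fs (wl ++ [ (w′ , false) ]) f∈ made sampled
  addWedges-adds (f ∷ fs) wl {w = w} (here refl) made sampled rewrite made | sampled with w ∈?W wedges wl in present
  ... | true = addWedges-keeps fs wl (any-≟-sound _≟W_ (wedges wl) present)
  ... | false = addWedges-keeps fs (wl ++ [ (w , false) ])
      (subst (_ ∈_) (sym (wedges-snoc wl w)) (∈-++⁺ʳ (wedges wl) (here refl)))

-- P is the processed prefix of the (normalised) stream, oldest edge first.
record Invariant (h : Hash) (P : List Edge) (S : State) : Set where
  field
    canonical : ∀ {f} → f ∈ P → Canonical f
    eList-sound : ∀ {f} → f ∈ eList S → f ∈ P × h (inj₁ f) ≡ true
    eList-complete : ∀ {f} → f ∈ P → h (inj₁ f) ≡ true → f ∈ eList S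
    wList-unique : Unique (wedges (wList S))
    wList-sound : ∀ {w} → w ∈ wedges (wList S) →
                  ∃ λ f → ∃ λ g → f ∈ eList S × g ∈ eList S × mkWedge f g ≡ just w × h (inj₂ w) ≡ true
    wList-complete : ∀ {w f g} → f ∈ eList S → g ∈ eList S → mkWedge f g ≡ just w → h (inj₂ w) ≡ true →
                     w ∈ wedges (wList S)
    bits : ∀ {x} → x ∈ wList S → proj₂ x ≡ closedBit (proj₁ x) (reverse P)

invariant-start : ∀ h → Invariant h [] (st [] [])
invariant-start h = record
  { canonical = λ ()
  ; eList-sound = λ ()
  ; eList-complete = λ ()
  ; wList-unique = []
  ; wList-sound = λ ()
  ; wList-complete = λ ()
  ; bits = λ ()
  }

canonical-snoc : ∀ {P e} → (∀ {f} → f ∈ P → Canonical f) → Canonical e →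
                 ∀ {f} → f ∈ P ++ [ e ] → Canonical f
canonical-snoc {P} P-can e-can f∈ with ∈-++⁻ P f∈
... | inj₁ f∈P = P-can f∈P
... | inj₂ (here refl) = e-can

bit-step : ∀ e P x → proj₂ x ≡ closedBit (proj₁ x) (reverse P) →
           proj₂ (updX e x) ≡ closedBit (proj₁ (updX e x)) (reverse (P ++ [ e ]))
bit-step e P (w , X) X≡ rewrite List.reverse-++ P [ e ] | updX-wedge e (w , X) | X≡ = refl

bit-inserted : ∀ e P x → proj₂ x ≡ false →
               e ≡ leg₁ (proj₁ x) ⊎ e ≡ leg₂ (proj₁ x) → e ≢ closing (proj₁ x) →
               proj₂ (updX e x) ≡ closedBit (proj₁ (updX e x)) (reverse (P ++ [ e ]))
bit-inserted e P (w , .false) refl e-leg e≢cl rewrite List.reverse-++ P [ e ] | updX-wedge e (w , false)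
  | updX-leg w false e≢cl e-leg | updX-leg w (closedBit w (reverse P)) e≢cl e-leg = refl

∈-wedges-updX : ∀ e wl {w} → w ∈ wedges wl → w ∈ wedges (map (updX e) wl)
∈-wedges-updX e wl = subst (_ ∈_) (sym (wedges-updX e wl))

∈-wedges-updX⁻ : ∀ e wl {w} → w ∈ wedges (map (updX e) wl) → w ∈ wedges wl
∈-wedges-updX⁻ e wl = subst (_ ∈_) (wedges-updX e wl)

module _ (h : Hash) (P : List Edge) (el : List Edge) (wl : List (Wedge × Bool)) (e : Edge)
         (I : Invariant h P (st el wl)) (e-can : Canonical e) where

  open Invariant I
  open AddWedges h e

  step-inserting : h (inj₁ e) ≡ true →
                   Invariant h (P ++ [ e ]) (st (e ∷ el) (map (updX e) (addWedges h e el wl)))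
  step-inserting e-sampled = record
    { canonical = canonical-snoc canonical e-can
    ; eList-sound = eList-sound′
    ; eList-complete = eList-complete′
    ; wList-unique = subst Unique (sym (wedges-updX e new)) (addWedges-unique el wl wList-unique)
    ; wList-sound = wList-sound′
    ; wList-complete = wList-complete′
    ; bits = bits′
    }
    where
      new = addWedges h e el wl
      el-can : ∀ {f} → f ∈ el → Canonical f
      el-can f∈ = canonical (proj₁ (eList-sound f∈))
      eList-sound′ : ∀ {f} → f ∈ e ∷ el → f ∈ P ++ [ e ] × h (inj₁ f) ≡ true
      eList-sound′ (here refl) = ∈-++⁺ʳ P (here refl) , e-sampled
      eList-sound′ (there f∈) = ∈-++⁺ˡ (proj₁ (eList-sound f∈)) , proj₂ (eList-sound f∈)
      eList-complete′ : ∀ {f} → f ∈ P ++ [ e ] → h (inj₁ f) ≡ true → f ∈ e ∷ el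
      eList-complete′ f∈ f-sampled with ∈-++⁻ P f∈
      ... | inj₁ f∈P = there (eList-complete f∈P f-sampled)
      ... | inj₂ (here refl) = here refl
      wList-sound′ : ∀ {w} → w ∈ wedges (map (updX e) new) →
                     ∃ λ f → ∃ λ g → f ∈ e ∷ el × g ∈ e ∷ el × mkWedge f g ≡ just w × h (inj₂ w) ≡ true
      wList-sound′ w∈ with ∈-map⁻ proj₁ (∈-wedges-updX⁻ e new w∈)
      ... | x , x∈ , refl with addWedges-∈⁻ el wl x∈
      ... | inj₁ x∈wl with wList-sound (∈-map⁺ proj₁ x∈wl)
      ...   | f , g , f∈ , g∈ , made , sampled = f , g , there f∈ , there g∈ , made , sampled
      wList-sound′ w∈ | x , x∈ , refl | inj₂ (_ , f , f∈ , made , sampled) =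
        f , e , there f∈ , here refl , made , sampled
      wList-complete′ : ∀ {w f g} → f ∈ e ∷ el → g ∈ e ∷ el → mkWedge f g ≡ just w → h (inj₂ w) ≡ true →
                        w ∈ wedges (map (updX e) new)
      wList-complete′ {f = f} (here refl) (here refl) made _ with () ← trans (sym made) (mkWedge-self f)
      wList-complete′ (here refl) (there g∈) made sampled =
        ∈-wedges-updX e new (addWedges-adds el wl g∈ (mkWedge-comm e-can (el-can g∈) made) sampled)
      wList-complete′ (there f∈) (here refl) made sampled = ∈-wedges-updX e new (addWedges-adds el wl f∈ made sampled)
      wList-complete′ (there f∈) (there g∈) made sampled =
        ∈-wedges-updX e new (addWedges-keeps el wl (wList-complete f∈ g∈ made sampled))
      bits′ : ∀ {x} → x ∈ map (updX e) new → proj₂ x ≡ closedBit (proj₁ x) (reverse (P ++ [ e ]))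
      bits′ x∈ with ∈-map⁻ (updX e) x∈
      ... | x , x∈new , refl with addWedges-∈⁻ el wl x∈new
      ... | inj₁ x∈wl = bit-step e P x (bits x∈wl)
      ... | inj₂ (X≡false , f , f∈ , made , _) with mkWedge-second-leg (el-can f∈) e-can made
      ...   | e-leg , e≢cl = bit-inserted e P x X≡false e-leg e≢cl

  step-skipping : (h (inj₁ e) ≡ true → e ∈ el) → Invariant h (P ++ [ e ]) (st el (map (updX e) wl))
  step-skipping e-known = record
    { canonical = canonical-snoc canonical e-can
    ; eList-sound = λ f∈ → ∈-++⁺ˡ (proj₁ (eList-sound f∈)) , proj₂ (eList-sound f∈)
    ; eList-complete = eList-complete′
    ; wList-unique = subst Unique (sym (wedges-updX e wl)) wList-unique
    ; wList-sound = λ w∈ → wList-sound (∈-wedges-updX⁻ e wl w∈)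
    ; wList-complete = λ f∈ g∈ made sampled → ∈-wedges-updX e wl (wList-complete f∈ g∈ made sampled)
    ; bits = bits′
    }
    where
      eList-complete′ : ∀ {f} → f ∈ P ++ [ e ] → h (inj₁ f) ≡ true → f ∈ el
      eList-complete′ f∈ f-sampled with ∈-++⁻ P f∈
      ... | inj₁ f∈P = eList-complete f∈P f-sampled
      ... | inj₂ (here refl) = e-known f-sampled
      bits′ : ∀ {x} → x ∈ map (updX e) wl → proj₂ x ≡ closedBit (proj₁ x) (reverse (P ++ [ e ]))
      bits′ x∈ with ∈-map⁻ (updX e) x∈
      ... | x , x∈wl , refl = bit-step e P x (bits x∈wl)

step-invariant : ∀ h P S e → Invariant h P S → Canonical e → Invariant h (P ++ [ e ]) (step h S e)
step-invariant h P (st el wl) e I e-can with h (inj₁ e) ∧ not (e ∈?E el) in insert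
... | true = step-inserting h P el wl e I e-can (proj₁ (∧-true insert))
... | false = step-skipping h P el wl e I e-can known
  where
    known : h (inj₁ e) ≡ true → e ∈ el
    known e-sampled with e ∈?E el in present
    ... | true = any-≟-sound _≟E_ el present
    ... | false with () ← trans (sym insert) (cong (_∧ true) e-sampled)

run-invariant : ∀ h P S Q → Invariant h P S → (∀ {f} → f ∈ Q → Canonical f) →
                Invariant h (P ++ Q) (foldl (step h) S Q)
run-invariant h P S [] I _ = subst (λ P′ → Invariant h P′ S) (sym (List.++-identityʳ P)) I
run-invariant h P S (e ∷ Q) I Q-can =
  subst (λ P′ → Invariant h P′ (foldl (step h) (step h S e) Q)) (List.++-assoc P [ e ] Q)
    (run-invariant h (P ++ [ e ]) (step h S e) Q (step-invariant h P S e I (Q-can (here refl))) (λ f∈ → Q-can (there f∈)))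

legs-sampled : ∀ (h : Hash) {w f g} → HasLegs w f g → h (inj₁ f) ≡ true → h (inj₁ g) ≡ true →
               h (inj₁ (leg₁ w)) ≡ true × h (inj₁ (leg₂ w)) ≡ true
legs-sampled h (inj₁ (refl , refl)) f-sampled g-sampled = f-sampled , g-sampled
legs-sampled h (inj₂ (refl , refl)) f-sampled g-sampled = g-sampled , f-sampled

module _ (s : List (ℕ × ℕ)) (s-loopless : All (λ p → proj₁ p ≢ proj₂ p) s) (Δt t : ℕ)
         (L : List (ℕ × ℕ × ℕ)) (L-unique : Unique L)
         (L-triangles : ∀ τ → (τ ∈ L) ⇔ IsTriangle (window Δt t s) τ) where

  -- G_t consists of the processed stream elements after the first `start`.
  start : ℕ
  start = (1 ⊔ (t ∸ Δt)) ∸ 1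

  processed G before : List Edge
  processed = map norm (take t s)
  G = window Δt t s
  before = map norm (take start (take t s))

  processed≡before++G : processed ≡ before ++ G
  processed≡before++G =
    trans (cong (map norm) (sym (List.take++drop≡id start (take t s))))
          (List.map-++ norm (take start (take t s)) (drop start (take t s)))

  history : List Edge
  history = reverse processed

  history≡ : history ≡ reverse G ++ reverse before
  history≡ = trans (cong reverse processed≡before++G) (List.reverse-++ before G)

  G⊆processed : ∀ {e} → e ∈ G → e ∈ processed
  G⊆processed e∈G = subst (_ ∈_) (sym processed≡before++G) (∈-++⁺ʳ before e∈G)

  processed⊆stream : ∀ {e} → e ∈ processed → e ∈ map norm s
  processed⊆stream e∈ with ∈-map⁻ norm e∈
  ... | _ , p∈ , refl = ∈-map⁺ norm (∈-take t s p∈)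

  processed-canonical : ∀ {e} → e ∈ processed → Canonical e
  processed-canonical e∈ with ∈-map⁻ norm e∈
  ... | (u , v) , p∈ , refl = norm-canonical u v (All.lookup s-loopless (∈-take t s p∈))

  G⊆stream : ∀ {e} → e ∈ G → e ∈ map norm s
  G⊆stream = processed⊆stream ∘ G⊆processed

  L-sorted : ∀ {τ} → τ ∈ L → Sorted τ
  L-sorted {a , b , c} τ∈ with Equivalence.to (L-triangles _) τ∈
  ... | a<b , b<c , _ = a<b , b<c

  corner-edges∈G : ∀ {τ w} → τ ∈ L → Corner τ w → closing w ∈ G × leg₁ w ∈ G × leg₂ w ∈ G
  corner-edges∈G {a , b , c} τ∈ corner with Equivalence.to (L-triangles _) τ∈
  ... | _ , _ , ab∈ , bc∈ , ac∈ = triangle⇒corner-edges corner (_∈ G) ab∈ bc∈ ac∈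

  module Run (h : Hash) where

    I : Invariant h processed (runTo h s t)
    I = run-invariant h [] (st [] []) processed (invariant-start h) processed-canonical

    inG : Wedge → Bool
    inG w = norm (proj₁ w , proj₁ (proj₂ w)) ∈?E G ∧ norm (proj₁ w , proj₂ (proj₂ w)) ∈?E G

    reported : Wedge → Bool
    reported w = closedBit w history ∧ inG w

    counted : Wedge → Bool
    counted w = h (inj₁ (leg₁ w)) ∧ (h (inj₁ (leg₂ w)) ∧ (h (inj₂ w) ∧ closedBit w history))

    reported⇒counted : ∀ {w} → w ∈ wedges (wList (runTo h s t)) → reported w ≡ true →
                       w ∈ cornersOf L × counted w ≡ true
    reported⇒counted w∈ rep with ∧-true rep | Invariant.wList-sound I w∈
    ... | closed , legs∈ | f , g , f∈ , g∈ , made , w-sampled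
      with Invariant.eList-sound I f∈ | Invariant.eList-sound I g∈ | ∧-true legs∈
    ... | f∈P , f-sampled | g∈P , g-sampled | leg₁∈? , leg₂∈?
      with mkWedge-sound (processed-canonical f∈P) (processed-canonical g∈P) made
    ... | (a , b , c) , corner , legs
      with legs-sampled h legs f-sampled g-sampled
    ... | leg₁-sampled , leg₂-sampled = ∈-cornersOf⁺ τ∈L corner ,
          ∧-true⁺ leg₁-sampled (∧-true⁺ leg₂-sampled (∧-true⁺ w-sampled closed))
      where
        leg₁∈G = any-≟-sound _≟E_ G leg₁∈?
        closing∈G = AnyP.reverse⁻ (closedBit-closing∈ _ (reverse G) (reverse before)
          (subst (λ R → closedBit _ R ≡ true) history≡ closed) (AnyP.reverse⁺ leg₁∈G) (inj₁ refl))
        τ∈L : (a , b , c) ∈ L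
        τ∈L with corner-sorted corner
               | corner-edges⇒triangle corner (_∈ G) closing∈G leg₁∈G (any-≟-sound _≟E_ G leg₂∈?)
        ... | a<b , b<c | ab∈ , bc∈ , ac∈ = Equivalence.from (L-triangles _) (a<b , b<c , ab∈ , bc∈ , ac∈)

    counted⇒reported : ∀ {w} → w ∈ cornersOf L → counted w ≡ true →
                       w ∈ wedges (wList (runTo h s t)) × reported w ≡ true
    counted⇒reported w∈ cnt with ∈-cornersOf⁻ L-sorted w∈ | ∧-true cnt
    ... | τ , τ∈ , corner | leg₁-sampled , rest with ∧-true rest
    ... | leg₂-sampled , rest′ with ∧-true rest′ | corner-edges∈G τ∈ corner
    ... | w-sampled , closed | _ , leg₁∈G , leg₂∈G =
      Invariant.wList-complete I (Invariant.eList-complete I (G⊆processed leg₁∈G) leg₁-sampled)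
        (Invariant.eList-complete I (G⊆processed leg₂∈G) leg₂-sampled) (proj₁ (mkWedge-corner corner)) w-sampled ,
      ∧-true⁺ closed (∧-true⁺ (any-≟-complete _≟E_ leg₁∈G) (any-≟-complete _≟E_ leg₂∈G))

    reported-count : countTrue (map (λ wX → proj₂ wX ∧ inG (proj₁ wX)) (wList (runTo h s t)))
                   ≡ countTrue (map counted (cornersOf L))
    reported-count = begin
      countTrue (map (λ wX → proj₂ wX ∧ inG (proj₁ wX)) wl)
        ≡⟨ countTrue-cong _ (reported ∘ proj₁) wl (λ x∈ → cong (_∧ inG _) (Invariant.bits I x∈)) ⟩
      countTrue (map (reported ∘ proj₁) wl)
        ≡⟨ cong countTrue (List.map-∘ wl) ⟩
      countTrue (map reported (wedges wl))
        ≡⟨ countTrue-unique reported counted (wedges wl) (cornersOf L) (Invariant.wList-unique I)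
             (cornersOf-unique L-unique L-sorted) reported⇒counted counted⇒reported ⟩
      countTrue (map counted (cornersOf L))
        ∎
      where
        open ≡-Reasoning
        wl = wList (runTo h s t)

  edge∈keys : ∀ {e} → e ∈ G → inj₁ e ∈ keys s
  edge∈keys e∈G = ∈-++⁺ˡ (∈-map⁺ inj₁ (G⊆stream e∈G))

  corner∈keys : ∀ {w} → w ∈ cornersOf L → inj₂ w ∈ keys s
  corner∈keys w∈ with ∈-cornersOf⁻ L-sorted w∈
  ... | τ , τ∈ , corner with corner-edges∈G τ∈ corner
  ... | _ , leg₁∈G , leg₂∈G = ∈-++⁺ʳ (map inj₁ (map norm s)) (∈-map⁺ inj₂
        (∈-mapMaybe⁺ (∈-cartesianProduct⁺ (G⊆stream leg₁∈G) (G⊆stream leg₂∈G))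
                     (proj₁ (mkWedge-corner corner))))

  module _ (α β : ℚ) (0<α : 0ℚ ℚ.< α) (0<β : 0ℚ ℚ.< β) where

    open Expectation (prob α β)
    open Run

    K : ℚ
    K = α ℚ.* α ℚ.* β

    inv-K*K : inv K ℚ.* K ≡ 1ℚ
    inv-K*K with K ℚ.≟ 0ℚ
    ... | yes K≡0 = ⊥-elim (ℚ.<⇒≢ (ℚ.positive⁻¹ K) (sym K≡0))
      where instance
        _ = ℚ.positive 0<α
        _ = ℚ.positive 0<β
        _ = ℚ.pos*pos⇒pos α α
        _ = ℚ.pos*pos⇒pos (α ℚ.* α) β
    ... | no K≢0 = ℚ.*-inverseˡ K {{ℚ.≢-nonZero K≢0}}

    Exp-counted : ∀ {w} → w ∈ cornersOf L →
                  Exp (prob α β) (keys s) (λ h → 𝟙 (counted h w)) ≡ K ℚ.* 𝟙 (closedBit w history)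
    Exp-counted {w} w∈ with ∈-cornersOf⁻ L-sorted w∈
    ... | τ , τ∈ , corner with corner-edges∈G τ∈ corner
    ... | _ , leg₁∈G , leg₂∈G = trans
      (Exp-three-sampled (keys s) (edge∈keys leg₁∈G) (edge∈keys leg₂∈G) (corner∈keys w∈)
         (proj₂ (proj₂ (corner-edges-distinct corner)) ∘ inj₁-injective) (λ ()) (λ ()) (closedBit w history))
      (reassoc α β (𝟙 (closedBit w history)))
      where
        open +-*-Solver
        reassoc : ∀ a b x → a ℚ.* (a ℚ.* (b ℚ.* x)) ≡ a ℚ.* a ℚ.* b ℚ.* x
        reassoc = solve 3 (λ a b x → a :* (a :* (b :* x)) := a :* a :* b :* x) refl

    That-counted : ∀ h → That α β Δt s t h ≡ inv K ℚ.* sumℚ (map (λ w → 𝟙 (counted h w)) (cornersOf L))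
    That-counted h = cong (inv K ℚ.*_)
      (trans (cong (λ n → (+ n) / 1) (reported-count h)) (countTrue-sum (counted h) (cornersOf L)))

    That-unbiased : Exp (prob α β) (keys s) (That α β Δt s t) ≡ (+ length L) / 1
    That-unbiased = begin
      Exp (prob α β) (keys s) (That α β Δt s t)
        ≡⟨ Exp-cong (keys s) That-counted ⟩
      Exp (prob α β) (keys s) (λ h → inv K ℚ.* sumℚ (map (λ w → 𝟙 (counted h w)) (cornersOf L)))
        ≡⟨ Exp-* (keys s) (inv K) _ ⟩
      inv K ℚ.* Exp (prob α β) (keys s) (λ h → sumℚ (map (λ w → 𝟙 (counted h w)) (cornersOf L)))
        ≡⟨ cong (inv K ℚ.*_) (Exp-sum (keys s) (cornersOf L) (λ w h → 𝟙 (counted h w))) ⟩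
      inv K ℚ.* sumℚ (map (λ w → Exp (prob α β) (keys s) (λ h → 𝟙 (counted h w))) (cornersOf L))
        ≡⟨ cong (inv K ℚ.*_) (sumℚ-cong _ _ (cornersOf L) (λ w w∈ → Exp-counted w∈)) ⟩
      inv K ℚ.* sumℚ (map (λ w → K ℚ.* 𝟙 (closedBit w history)) (cornersOf L))
        ≡⟨ cong (inv K ℚ.*_) (sumℚ-* K (λ w → 𝟙 (closedBit w history)) (cornersOf L)) ⟩
      inv K ℚ.* (K ℚ.* sumℚ (map (λ w → 𝟙 (closedBit w history)) (cornersOf L)))
        ≡⟨ cong (λ x → inv K ℚ.* (K ℚ.* x)) (closedBit-cornersOf L history L-seen) ⟩
      inv K ℚ.* (K ℚ.* ((+ length L) / 1))
        ≡⟨ ℚ.*-assoc (inv K) K _ ⟨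
      inv K ℚ.* K ℚ.* ((+ length L) / 1)
        ≡⟨ cong (ℚ._* ((+ length L) / 1)) inv-K*K ⟩
      1ℚ ℚ.* ((+ length L) / 1)
        ≡⟨ ℚ.*-identityˡ _ ⟩
      ((+ length L) / 1)
        ∎
      where
        open ≡-Reasoning
        L-seen : ∀ {τ} → τ ∈ L → Sorted τ × edgeAB τ ∈ history
        L-seen {a , b , c} τ∈ with Equivalence.to (L-triangles _) τ∈
        ... | a<b , b<c , ab∈G , _ = (a<b , b<c) , AnyP.reverse⁺ (G⊆processed ab∈G)

theorem3p4 : (s : List (ℕ × ℕ)) → All (λ p → proj₁ p ≢ proj₂ p) s →
             (α β : ℚ) → 0ℚ ℚ.< α → α ℚ.< 1ℚ → 0ℚ ℚ.< β → β ℚ.< 1ℚ →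
             (Δt t : ℕ) → 1 ≤ t → t ≤ length s →
             (L : List (ℕ × ℕ × ℕ)) → Unique L →
             (∀ τ → (τ ∈ L) ⇔ IsTriangle (window Δt t s) τ) →
             Exp (prob α β) (keys s) (That α β Δt s t) ≡ (+ length L) / 1
theorem3p4 s s-loopless α β 0<α _ 0<β _ Δt t _ _ L L-unique L-triangles =
  That-unbiased s s-loopless Δt t L L-unique L-triangles α β 0<α 0<β
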